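{- Let $n \geq 5$ be odd and $d \geq 2$ be integers, and consider the game $Z(n,d)$. Suppose that at some game state the set $M \subseteq \{1,\dots,n\}$ of numbers remaining on the board satisfies $|M| \geq 4$, that it is Player $B$'s turn to move, and that the state is an $A$-situation. Then Player $A$ has a strategy that wins against every sequence of moves of $B$ from this state.
   Context: For integers $n \geq 4$ and $d \geq 2$, $Z(n,d)$ is the following two-player game. Initially the board contains the numbers $1,2,\dots,n$. Players $A$ and $B$ alternately cross out (remove) one number from the board, with $A$ moving first, until exactly two numbers remain. If the sum of the two remaining numbers is divisible by $d$, $A$ wins; otherwise $B$ wins. For a game state with board $M$ and a residue $r \in \{0,\dots,d-1\}$, let $a_r = |\{x \in M : x \equiv r \pmod d\}|$. Let $I_d = \{0, d/2\}$ if $d$ is even and $I_d = \{0\}$ if $d$ is odd. A game state is called an $A$-situation if $a_r = a_{d-r}$ for all $r \in \{0,\dots,d-1\}\setminus I_d$ and $a_{\hat r}$ is even for all $\hat r \in I_d$. -}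

module Defs where

open import Data.Nat using (ℕ; zero; suc; _+_; _*_; _∸_; _≤_; _<_; NonZero; _≡ᵇ_)
open import Data.Nat.DivMod using (_%_)
open import Data.Nat.Divisibility using (_∣_)
open import Data.Nat.Properties using ()
open import Data.Bool using (Bool; true; false; _∧_; T)
open import Data.Bool.Properties using (T?)
open import Data.Fin using (Fin; toℕ)
open import Data.Fin.Subset using (Subset; _∈_; _-_; ∣_∣)
open import Data.Vec using (lookup)
open import Data.List using (List; filter; map; length; allFin)
open import Data.Nat.ListAction using (sum)
open import Data.Product using (Σ; _×_)
open import Data.Sum using (_⊎_)
open import Relation.Binary.PropositionalEquality using (_≡_; _≢_)
open import Relation.Nullary using (¬_)

-- A board is a subset of {1,…,n}: index i : Fin n stands for the number toℕ i + 1.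
num : {n : ℕ} → Fin n → ℕ
num i = suc (toℕ i)

elems : {n : ℕ} → Subset n → List ℕ
elems {n} M = map num (filter (λ i → T? (lookup M i)) (allFin n))

residueCount : {n : ℕ} (d : ℕ) .{{_ : NonZero d}} → ℕ → Subset n → ℕ
residueCount d r M = length (filter (λ x → T? ((x % d) ≡ᵇ r)) (elems M))

InI : ℕ → ℕ → Set
InI d r = r ≡ 0 ⊎ 2 * r ≡ d

data Even : ℕ → Set where
  even0  : Even 0
  even+2 : ∀ {k} → Even k → Even (suc (suc k))

ASituation : {n : ℕ} (d : ℕ) .{{_ : NonZero d}} → Subset n → Set
ASituation d M =
  (∀ r → r < d → ¬ InI d r → residueCount d r M ≡ residueCount d (d ∸ r) M)
  × (∀ r → r < d → InI d r → Even (residueCount d r M))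

data Player : Set where
  PA PB : Player

-- whose turn it is in Z(n,d) when the board has |M| numbers left
-- (A moves first, so after an even number n − |M| of removals it is A's turn)
data Turn (n : ℕ) (M : Subset n) : Player → Set where
  turnA : Even (n ∸ ∣ M ∣) → Turn n M PA
  turnB : ¬ Even (n ∸ ∣ M ∣) → Turn n M PB

-- AWins d p M : from board M with player p to move, player A has a strategy
-- that wins against every play of B (game ends when two numbers remain;
-- A wins iff their sum is divisible by d).
data AWins {n : ℕ} (d : ℕ) : Player → Subset n → Set where
  finished : ∀ {p M} → ∣ M ∣ ≡ 2 → d ∣ sum (elems M) → AWins d p M
  moveA    : ∀ {M} → 2 < ∣ M ∣ → (i : Fin n) → i ∈ M → AWins d PB (M - i) → AWins d PA M
  moveB    : ∀ {M} → 2 < ∣ M ∣ → (∀ (i : Fin n) → i ∈ M → AWins d PA (M - i)) → AWins d PB M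

-- Whenever B removes a number of residue r, A removes one of residue −r (mod d).
-- The removed pair is itself balanced in the sense of an A-situation, so the
-- A-situation is preserved; one partner is always available because before B's
-- move a_{−r} = a_r ≥ 1 (resp. a_r is even for r ∈ I_d).  Since n is odd and B is
-- to move, |M| is even, so the game ends after one of A's moves in an A-situation
-- with two numbers left, and then their residues are partners, i.e. sum to 0 mod d.
module Submission where

open import Defs
open import Data.Nat using (ℕ; zero; suc; _+_; _*_; _∸_; _≤_; _<_; NonZero; _≡ᵇ_; z≤n; s≤s)
open import Data.Nat.Properties
  using (_≟_; ≡ᵇ⇒≡; +-assoc; +-comm; +-commutativeSemigroup; +-identityʳ; +-cancelˡ-≡; +-suc; 1+n≢0; suc-injective; ≤-trans; m∸n≤m;
         <⇒≤; <⇒≱; m∸n≡0⇒m≤n; m+n∸m≡n; m+[n∸m]≡n; m∸[m∸n]≡n; m∸n+n≡m; ∸-cancelˡ-≡)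
open import Data.Nat.DivMod using (_%_; m%n<n; %-distribˡ-+)
open import Data.Nat.Divisibility using (_∣_; _∣0; ∣-reflexive; m%n≡0⇒n∣m; n∣m⇒m%n≡0)
open import Data.Nat.ListAction using (sum)
open import Data.Bool using (Bool; true; false; _∧_; T)
open import Data.Bool.Properties using (T?)
open import Data.Fin using (Fin) renaming (zero to fzero; suc to fsuc)
open import Data.Fin.Subset using (Subset; _∈_; _-_; ∣_∣; inside; outside)
open import Data.Fin.Subset.Properties using (p─⊥≡p; ∣p∣≤n)
open import Data.Vec using ([]; _∷_; lookup; here; there)
open import Data.Vec.Properties using (lookup⇒[]=)
open import Data.List using (List; []; _∷_; filter; map; length; tabulate; allFin)
open import Data.List.Properties using (length-map)
open import Data.Product using (∃; _×_; _,_)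
open import Data.Sum using (_⊎_; inj₁; inj₂)
open import Data.Unit using (tt)
open import Function using (_∘_; id)
open import Relation.Binary.PropositionalEquality
  using (_≡_; _≢_; refl; sym; trans; cong; cong₂; subst; module ≡-Reasoning)
open import Relation.Nullary using (¬_; Dec; yes; no; contradiction)
open import Relation.Nullary.Decidable using (_⊎-dec_)
open import Algebra.Properties.CommutativeSemigroup +-commutativeSemigroup using (x∙yz≈y∙xz)

open ≡-Reasoning

Even-+ : ∀ {a b} → Even a → Even b → Even (a + b)
Even-+ even0 eb = eb
Even-+ (even+2 ea) eb = even+2 (Even-+ ea eb)

Even-cancelˡ : ∀ {a b} → Even a → Even (a + b) → Even b
Even-cancelˡ even0 e = e
Even-cancelˡ (even+2 ea) (even+2 e) = Even-cancelˡ ea e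

Even-double : ∀ a → Even (a + a)
Even-double zero = even0
Even-double (suc a) = subst (Even ∘ suc) (sym (+-suc a a)) (even+2 (Even-double a))

Even-suc⇒pos : ∀ {c} → Even (suc c) → 0 < c
Even-suc⇒pos {suc c} _ = s≤s z≤n

Even⇒2+Even : ∀ {k} → Even k → 2 ≤ k → ∃ λ m → Even m × k ≡ 2 + m
Even⇒2+Even (even+2 e) _ = _ , e , refl

¬Even-1 : ¬ Even 1
¬Even-1 ()

even-or-odd : ∀ m → Even m ⊎ Even (suc m)
even-or-odd zero = inj₁ even0
even-or-odd (suc m) with even-or-odd m
... | inj₁ e = inj₂ (even+2 e)
... | inj₂ e = inj₁ e

odd-∸-odd⇒even : ∀ {n m} → m ≤ n → ¬ Even n → ¬ Even (n ∸ m) → Even m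
odd-∸-odd⇒even {n} {m} m≤n n-odd n∸m-odd with even-or-odd m | even-or-odd (n ∸ m)
... | inj₁ m-even | _ = m-even
... | inj₂ _ | inj₁ n∸m-even = contradiction n∸m-even n∸m-odd
... | inj₂ sm-even | inj₂ sn∸m-even
  with even+2 e ← subst Even (cong suc (+-suc (n ∸ m) m)) (Even-+ sn∸m-even sm-even)
  = contradiction (subst Even (m∸n+n≡m m≤n) e) n-odd

fromBool : Bool → ℕ
fromBool true = 1
fromBool false = 0

countFin : ∀ {n} → (Fin n → Bool) → ℕ
countFin {zero} _ = 0
countFin {suc n} φ = fromBool (φ fzero) + countFin (φ ∘ fsuc)

countFin-pos : ∀ {n} (φ : Fin n → Bool) → 0 < countFin φ → ∃ λ j → φ j ≡ true
countFin-pos {suc n} φ pos with φ fzero in φ0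
... | true = fzero , φ0
... | false with j , φj ← countFin-pos (φ ∘ fsuc) pos = fsuc j , φj

∣p∣≡countFin : ∀ {n} (M : Subset n) → ∣ M ∣ ≡ countFin (lookup M)
∣p∣≡countFin [] = refl
∣p∣≡countFin (inside ∷ M) = cong suc (∣p∣≡countFin M)
∣p∣≡countFin (outside ∷ M) = ∣p∣≡countFin M

∣p∣≡1+∣p-x∣ : ∀ {n} {M : Subset n} {i} → i ∈ M → ∣ M ∣ ≡ suc ∣ M - i ∣
∣p∣≡1+∣p-x∣ {M = inside ∷ M} here = cong (suc ∘ ∣_∣) (sym (p─⊥≡p M))
∣p∣≡1+∣p-x∣ {M = inside ∷ M} (there i∈M) = cong suc (∣p∣≡1+∣p-x∣ i∈M)
∣p∣≡1+∣p-x∣ {M = outside ∷ M} (there i∈M) = ∣p∣≡1+∣p-x∣ i∈M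

length-filter-tabulate : ∀ {A : Set} {n} (p : A → Bool) (g : Fin n → A) →
  length (filter (T? ∘ p) (tabulate g)) ≡ countFin (p ∘ g)
length-filter-tabulate {n = zero} p g = refl
length-filter-tabulate {n = suc n} p g with p (g fzero)
... | true = cong suc (length-filter-tabulate p (g ∘ fsuc))
... | false = length-filter-tabulate p (g ∘ fsuc)

length-filter-map-filter : ∀ {A B : Set} (p : A → Bool) (f : A → B) (q : B → Bool) (xs : List A) →
  length (filter (T? ∘ q) (map f (filter (T? ∘ p) xs)))
    ≡ length (filter (λ x → T? (p x ∧ q (f x))) xs)
length-filter-map-filter p f q [] = refl
length-filter-map-filter p f q (x ∷ xs) with p x
... | false = length-filter-map-filter p f q xs
... | true with q (f x)
...   | true = cong suc (length-filter-map-filter p f q xs)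
...   | false = length-filter-map-filter p f q xs

length-filter-∷ : ∀ {A : Set} (q : A → Bool) x xs →
  length (filter (T? ∘ q) (x ∷ xs)) ≡ fromBool (q x) + length (filter (T? ∘ q) xs)
length-filter-∷ q x xs with q x
... | true = refl
... | false = refl

countOn : ∀ {n} → (ℕ → Bool) → Subset n → ℕ
countOn q M = length (filter (T? ∘ q) (elems M))

countOn≡countFin : ∀ {n} (q : ℕ → Bool) (M : Subset n) →
  countOn q M ≡ countFin (λ j → lookup M j ∧ q (num j))
countOn≡countFin {n} q M = trans
  (length-filter-map-filter (lookup M) num q (allFin n))
  (length-filter-tabulate (λ j → lookup M j ∧ q (num j)) id)

length-elems : ∀ {n} (M : Subset n) → length (elems M) ≡ ∣ M ∣
length-elems M = begin
  length (elems M)                                          ≡⟨ length-map num (filter (T? ∘ lookup M) (allFin _)) ⟩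
  length (filter (T? ∘ lookup M) (allFin _))                ≡⟨ length-filter-tabulate (lookup M) id ⟩
  countFin (lookup M)                                       ≡⟨ sym (∣p∣≡countFin M) ⟩
  ∣ M ∣                                                     ∎

countFin-remove : ∀ {n} {M : Subset n} {i} (φ : Fin n → Bool) → i ∈ M →
  countFin (λ j → lookup M j ∧ φ j) ≡ fromBool (φ i) + countFin (λ j → lookup (M - i) j ∧ φ j)
countFin-remove {M = _ ∷ M} φ here =
  cong (λ N → fromBool (φ fzero) + countFin (λ j → lookup N j ∧ φ (fsuc j))) (sym (p─⊥≡p M))
countFin-remove {M = b ∷ M} {fsuc i} φ (there i∈M) = trans
  (cong (fromBool (b ∧ φ fzero) +_) (countFin-remove (φ ∘ fsuc) i∈M))
  (x∙yz≈y∙xz (fromBool (b ∧ φ fzero)) (fromBool (φ (fsuc i))) _)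

countOn-remove : ∀ {n} {M : Subset n} {i} (q : ℕ → Bool) → i ∈ M →
  countOn q M ≡ fromBool (q (num i)) + countOn q (M - i)
countOn-remove {M = M} {i} q i∈M = begin
  countOn q M                                                     ≡⟨ countOn≡countFin q M ⟩
  countFin (λ j → lookup M j ∧ q (num j))                         ≡⟨ countFin-remove (q ∘ num) i∈M ⟩
  fromBool (q (num i)) + countFin (λ j → lookup (M - i) j ∧ q (num j))
    ≡⟨ cong (fromBool (q (num i)) +_) (sym (countOn≡countFin q (M - i))) ⟩
  fromBool (q (num i)) + countOn q (M - i)                        ∎

countOn-pos : ∀ {n} (q : ℕ → Bool) (M : Subset n) → 0 < countOn q M →
  ∃ λ j → j ∈ M × q (num j) ≡ true
countOn-pos q M pos
  with j , Mj∧qj ← countFin-pos _ (subst (0 <_) (countOn≡countFin q M) pos)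
  with lookup M j in Mj | q (num j) in qj
... | true | true = j , lookup⇒[]= j M Mj , qj

δ : ℕ → ℕ → ℕ
δ a b = fromBool (a ≡ᵇ b)

δ-refl : ∀ a → δ a a ≡ 1
δ-refl zero = refl
δ-refl (suc a) = δ-refl a

δ-≢ : ∀ {a b} → a ≢ b → δ a b ≡ 0
δ-≢ {a} {b} a≢b with a ≡ᵇ b in eq
... | false = refl
... | true = contradiction (≡ᵇ⇒≡ a b (subst T (sym eq) tt)) a≢b

δ-cases : ∀ a b → a ≡ b ⊎ δ a b ≡ 0
δ-cases a b with a ≟ b
... | yes a≡b = inj₁ a≡b
... | no a≢b = inj₂ (δ-≢ a≢b)

δ-injective-map : ∀ {a b} (f : ℕ → ℕ) → (f a ≡ f b → a ≡ b) → δ (f a) (f b) ≡ δ a b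
δ-injective-map {a} {b} f f-inj with a ≟ b
... | yes refl = trans (δ-refl (f a)) (sym (δ-refl a))
... | no a≢b = trans (δ-≢ (a≢b ∘ f-inj)) (sym (δ-≢ a≢b))

module Residues (d : ℕ) .{{_ : NonZero d}} where

  InI? : ∀ r → Dec (InI d r)
  InI? r = (r ≟ 0) ⊎-dec (2 * r ≟ d)

  InI-mirror : ∀ {t} → t < d → InI d (d ∸ t) → InI d t
  InI-mirror t<d (inj₁ d∸t≡0) = contradiction (m∸n≡0⇒m≤n d∸t≡0) (<⇒≱ t<d)
  InI-mirror {t} t<d (inj₂ 2u≡d) = inj₂ (trans (cong (λ z → z + (z + 0)) t≡u) 2u≡d)
    where
    u = d ∸ t
    t≡u : t ≡ u
    t≡u = begin
      t               ≡⟨ sym (m∸[m∸n]≡n (<⇒≤ t<d)) ⟩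
      d ∸ u           ≡⟨ cong (_∸ u) (sym 2u≡d) ⟩
      u + (u + 0) ∸ u ≡⟨ m+n∸m≡n u (u + 0) ⟩
      u + 0           ≡⟨ +-identityʳ u ⟩
      u               ∎

  ≡mirror⇒InI : ∀ {r} → r ≤ d → r ≡ d ∸ r → InI d r
  ≡mirror⇒InI {r} r≤d r≡d∸r = inj₂ (begin
    r + (r + 0)  ≡⟨ cong (r +_) (+-identityʳ r) ⟩
    r + r        ≡⟨ cong (r +_) r≡d∸r ⟩
    r + (d ∸ r)  ≡⟨ m+[n∸m]≡n r≤d ⟩
    d            ∎)

  -- Partner r s says s ≡ −r (mod d): A answers B's removal of residue r with residue s.
  data Partner (r : ℕ) : ℕ → Set where
    self   : InI d r → Partner r r
    mirror : ¬ InI d r → Partner r (d ∸ r)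

  partner : ∀ r → ∃ (Partner r)
  partner r with InI? r
  ... | yes r∈I = r , self r∈I
  ... | no r∉I = d ∸ r , mirror r∉I

  Partner⇒∣+ : ∀ {r s} → r < d → Partner r s → d ∣ r + s
  Partner⇒∣+ _ (self (inj₁ refl)) = d ∣0
  Partner⇒∣+ {r} _ (self (inj₂ 2r≡d)) = ∣-reflexive (trans (sym 2r≡d) (cong (r +_) (+-identityʳ r)))
  Partner⇒∣+ r<d (mirror _) = ∣-reflexive (sym (m+[n∸m]≡n (<⇒≤ r<d)))

  -- ASituation d M is, definitionally, Balanced (λ r → residueCount d r M).
  Balanced : (ℕ → ℕ) → Set
  Balanced c = (∀ r → r < d → ¬ InI d r → c r ≡ c (d ∸ r)) × (∀ r → r < d → InI d r → Even (c r))

  Balanced-cong : ∀ {c c′} → (∀ t → c t ≡ c′ t) → Balanced c → Balanced c′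
  Balanced-cong c≗c′ (symm , even) =
    (λ t t<d t∉I → trans (sym (c≗c′ t)) (trans (symm t t<d t∉I) (c≗c′ (d ∸ t)))) ,
    (λ t t<d t∈I → subst Even (c≗c′ t) (even t t<d t∈I))

  Balanced-cancelˡ : ∀ {e c} → Balanced e → Balanced (λ t → e t + c t) → Balanced c
  Balanced-cancelˡ {e} {c} (e-symm , e-even) (symm , even) =
    (λ t t<d t∉I → +-cancelˡ-≡ (e t) _ _
      (trans (symm t t<d t∉I) (cong (_+ c (d ∸ t)) (sym (e-symm t t<d t∉I))))) ,
    (λ t t<d t∈I → Even-cancelˡ (e-even t t<d t∈I) (even t t<d t∈I))

  pairCounts : ℕ → ℕ → ℕ → ℕ
  pairCounts r s t = δ r t + δ s t

  δ-mirror : ∀ {r t} → r < d → t < d → δ (d ∸ r) t ≡ δ r (d ∸ t)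
  δ-mirror {r} {t} r<d t<d = begin
    δ (d ∸ r) t              ≡⟨ cong (δ (d ∸ r)) (sym (m∸[m∸n]≡n (<⇒≤ t<d))) ⟩
    δ (d ∸ r) (d ∸ (d ∸ t))  ≡⟨ δ-injective-map (d ∸_) (∸-cancelˡ-≡ (<⇒≤ r<d) (m∸n≤m d t)) ⟩
    δ r (d ∸ t)              ∎

  pairCounts-balanced : ∀ {r s} → r < d → Partner r s → Balanced (pairCounts r s)
  pairCounts-balanced {r} r<d (self r∈I) = symm , even
    where
    ≢r : ∀ {t} → t < d → ¬ InI d t → r ≢ t × r ≢ d ∸ t
    ≢r t<d t∉I = (λ { refl → t∉I r∈I }) , (λ { refl → t∉I (InI-mirror t<d r∈I) })
    symm : ∀ t → t < d → ¬ InI d t → pairCounts r r t ≡ pairCounts r r (d ∸ t)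
    symm t t<d t∉I with r≢t , r≢d∸t ← ≢r t<d t∉I
      rewrite δ-≢ r≢t | δ-≢ r≢d∸t = refl
    even : ∀ t → t < d → InI d t → Even (pairCounts r r t)
    even t _ _ = Even-double (δ r t)
  pairCounts-balanced {r} r<d (mirror r∉I) = symm , even
    where
    symm : ∀ t → t < d → ¬ InI d t → pairCounts r (d ∸ r) t ≡ pairCounts r (d ∸ r) (d ∸ t)
    symm t t<d _ = begin
      δ r t + δ (d ∸ r) t              ≡⟨ +-comm (δ r t) _ ⟩
      δ (d ∸ r) t + δ r t              ≡⟨ cong₂ _+_ (δ-mirror r<d t<d) (sym (δ-injective-map (d ∸_) (∸-cancelˡ-≡ (<⇒≤ r<d) (<⇒≤ t<d)))) ⟩
      δ r (d ∸ t) + δ (d ∸ r) (d ∸ t)  ∎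
    even : ∀ t → t < d → InI d t → Even (pairCounts r (d ∸ r) t)
    even t t<d t∈I
      rewrite δ-≢ {r} {t} (λ { refl → r∉I t∈I })
            | δ-≢ {d ∸ r} {t} (λ { refl → r∉I (InI-mirror r<d t∈I) }) = even0

  Balanced-pairCounts⇒Partner : ∀ {r s} → r < d → Balanced (pairCounts r s) → Partner r s
  Balanced-pairCounts⇒Partner {r} {s} r<d (symm , even) with InI? r
  ... | yes r∈I with δ-cases s r
  ...   | inj₁ refl = self r∈I
  ...   | inj₂ δsr≡0 = contradiction (subst Even (cong₂ _+_ (δ-refl r) δsr≡0) (even r r<d r∈I)) ¬Even-1
  Balanced-pairCounts⇒Partner {r} {s} r<d (symm , even) | no r∉I with δ-cases s (d ∸ r)
  ...   | inj₁ refl = mirror r∉I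
  ...   | inj₂ δs[d∸r]≡0 = contradiction (begin
    suc (δ s r)                  ≡⟨ cong (_+ δ s r) (sym (δ-refl r)) ⟩
    δ r r + δ s r                ≡⟨ symm r r<d r∉I ⟩
    δ r (d ∸ r) + δ s (d ∸ r)    ≡⟨ cong₂ _+_ (δ-≢ (r∉I ∘ ≡mirror⇒InI (<⇒≤ r<d))) δs[d∸r]≡0 ⟩
    0                            ∎) 1+n≢0

module Game (d : ℕ) .{{_ : NonZero d}} where

  open Residues d

  residueCounts : List ℕ → ℕ → ℕ
  residueCounts xs t = length (filter (λ x → T? ((x % d) ≡ᵇ t)) xs)

  counts : ∀ {n} → Subset n → ℕ → ℕ
  counts M t = residueCount d t M

  counts-remove : ∀ {n} {M : Subset n} {i} → i ∈ M → ∀ t → counts M t ≡ δ (num i % d) t + counts (M - i) t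
  counts-remove i∈M t = countOn-remove (λ x → (x % d) ≡ᵇ t) i∈M

  residueCounts-two : ∀ x y t → residueCounts (x ∷ y ∷ []) t ≡ pairCounts (x % d) (y % d) t
  residueCounts-two x y t = begin
    residueCounts (x ∷ y ∷ []) t          ≡⟨ length-filter-∷ q x (y ∷ []) ⟩
    δ (x % d) t + residueCounts (y ∷ []) t ≡⟨ cong (δ (x % d) t +_) (length-filter-∷ q y []) ⟩
    δ (x % d) t + (δ (y % d) t + 0)       ≡⟨ cong (δ (x % d) t +_) (+-identityʳ _) ⟩
    pairCounts (x % d) (y % d) t                ∎
    where q = λ z → (z % d) ≡ᵇ t

  ∣%+%⇒∣+ : ∀ x y → d ∣ x % d + y % d → d ∣ x + y
  ∣%+%⇒∣+ x y d∣ = m%n≡0⇒n∣m (x + y) d (trans (%-distribˡ-+ x y d) (n∣m⇒m%n≡0 _ d d∣))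

  balanced-two⇒∣sum : ∀ xs → length xs ≡ 2 → Balanced (residueCounts xs) → d ∣ sum xs
  balanced-two⇒∣sum (x ∷ y ∷ []) _ bal = subst (d ∣_) (cong (x +_) (sym (+-identityʳ y)))
    (∣%+%⇒∣+ x y (Partner⇒∣+ (m%n<n x d)
      (Balanced-pairCounts⇒Partner (m%n<n x d) (Balanced-cong (residueCounts-two x y) bal))))

  partner-available : ∀ {n} {M : Subset n} {i s} → ASituation d M → i ∈ M →
    Partner (num i % d) s → 0 < counts (M - i) s
  partner-available {M = M} {i} (symm , even) i∈M (self r∈I) =
    Even-suc⇒pos (subst Even (trans (counts-remove i∈M r) (cong (_+ counts (M - i) r) (δ-refl r)))
                           (even r (m%n<n (num i) d) r∈I))
    where r = num i % d
  partner-available {M = M} {i} (symm , even) i∈M (mirror r∉I) = subst (0 <_) (sym (begin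
    counts (M - i) (d ∸ r)                ≡⟨ cong (_+ counts (M - i) (d ∸ r)) (sym (δ-≢ (r∉I ∘ ≡mirror⇒InI (<⇒≤ r<d)))) ⟩
    δ r (d ∸ r) + counts (M - i) (d ∸ r)  ≡⟨ sym (counts-remove i∈M (d ∸ r)) ⟩
    counts M (d ∸ r)                      ≡⟨ sym (symm r r<d r∉I) ⟩
    counts M r                            ≡⟨ counts-remove i∈M r ⟩
    δ r r + counts (M - i) r              ≡⟨ cong (_+ counts (M - i) r) (δ-refl r) ⟩
    suc (counts (M - i) r)                ∎)) (s≤s z≤n)
    where
    r = num i % d
    r<d = m%n<n (num i) d

  reply : ∀ {n} {M : Subset n} {i} → ASituation d M → i ∈ M →
    ∃ λ j → j ∈ M - i × Partner (num i % d) (num j % d)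
  reply {M = M} {i} sit i∈M with s , r~s ← partner (num i % d)
    with j , j∈M-i , js ← countOn-pos (λ x → (x % d) ≡ᵇ s) (M - i) (partner-available sit i∈M r~s)
    = j , j∈M-i , subst (Partner (num i % d)) (sym (≡ᵇ⇒≡ _ _ (subst T (sym js) tt))) r~s

  ASituation-remove-pairCounts : ∀ {n} {M : Subset n} {i j} → ASituation d M → i ∈ M → j ∈ M - i →
    Partner (num i % d) (num j % d) → ASituation d (M - i - j)
  ASituation-remove-pairCounts {M = M} {i} {j} sit i∈M j∈M-i r~s =
    Balanced-cancelˡ (pairCounts-balanced (m%n<n (num i) d) r~s) (Balanced-cong removed sit)
    where
    r = num i % d
    s = num j % d
    removed : ∀ t → counts M t ≡ pairCounts r s t + counts (M - i - j) t
    removed t = begin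
      counts M t                                     ≡⟨ counts-remove i∈M t ⟩
      δ r t + counts (M - i) t                       ≡⟨ cong (δ r t +_) (counts-remove j∈M-i t) ⟩
      δ r t + (δ s t + counts (M - i - j) t)         ≡⟨ sym (+-assoc (δ r t) _ _) ⟩
      pairCounts r s t + counts (M - i - j) t              ∎

  ASituation⇒AWins : ∀ {n} {M : Subset n} {m} → Even m → ∣ M ∣ ≡ 2 + m → ASituation d M → AWins d PB M
  ASituation⇒AWins {M = M} even0 size sit = finished size (balanced-two⇒∣sum (elems M) (trans (length-elems M) size) sit)
  ASituation⇒AWins {M = M} {suc (suc m)} (even+2 m-even) size sit = moveB (subst (2 <_) (sym size) (s≤s (s≤s (s≤s z≤n)))) B-move
    where
    B-move : ∀ i → i ∈ M → AWins d PA (M - i)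
    B-move i i∈M with j , j∈M-i , r~s ← reply sit i∈M = moveA 2<∣M-i∣ j j∈M-i
      (ASituation⇒AWins m-even (suc-injective (trans (sym (∣p∣≡1+∣p-x∣ j∈M-i)) ∣M-i∣≡3+m)) (ASituation-remove-pairCounts sit i∈M j∈M-i r~s))
      where
      ∣M-i∣≡3+m : ∣ M - i ∣ ≡ 3 + m
      ∣M-i∣≡3+m = suc-injective (trans (sym (∣p∣≡1+∣p-x∣ i∈M)) size)
      2<∣M-i∣ : 2 < ∣ M - i ∣
      2<∣M-i∣ = subst (2 <_) (sym ∣M-i∣≡3+m) (s≤s (s≤s (s≤s z≤n)))

lemma3p1p2 : (n d : ℕ) .{{_ : NonZero d}} → 5 ≤ n → ¬ Even n → 2 ≤ d →
    (M : Subset n) → 4 ≤ ∣ M ∣ → Turn n M PB → ASituation d M →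
    AWins d PB M
lemma3p1p2 n d _ n-odd _ M 4≤∣M∣ (turnB n∸∣M∣-odd) sit
  with m , m-even , size ← Even⇒2+Even (odd-∸-odd⇒even (∣p∣≤n M) n-odd n∸∣M∣-odd) (≤-trans (s≤s (s≤s z≤n)) 4≤∣M∣)
  = Game.ASituation⇒AWins d m-even size sit
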